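{- Let $Q$ be a finite (left) quasifield with $q$ elements. If $A,B,C\subset Q$, then \[ |A + B\cdot C| \geq q - \frac{q^3}{|A||B||C| + q^2}. \]
   Context: A (left) quasifield is a set $Q$ with two binary operations $+$ and $\cdot$ such that $(Q,+)$ is a group with identity $0$; $(Q\setminus\{0\},\cdot)$ is a loop (for all $a,b$ the equations $a\cdot x=b$ and $y\cdot a=b$ have unique solutions, and there is an identity $1$); $a\cdot(b+c)=a\cdot b+a\cdot c$ for all $a,b,c$; $0\cdot x=0$ for all $x$; and for $a\neq b$ the equation $a\cdot x=b\cdot x+c$ has exactly one solution $x$. $A+B\cdot C = \{a + b\cdot c : a\in A, b\in B, c\in C\}$. -}

module Defs where

open import Level using (0ℓ)
open import Data.Nat using (ℕ)
open import Data.Fin using (Fin)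
open import Data.Fin.Properties using (_≟_; any?)
open import Data.Fin.Subset using (Subset; _∈_)
open import Data.Fin.Subset.Properties using (_∈?_)
open import Data.Product using (_×_; ∃; ∃!)
open import Data.Vec using (tabulate)
open import Relation.Nullary using (¬_)
open import Relation.Nullary.Decidable using (⌊_⌋; _×-dec_)
open import Relation.Binary.PropositionalEquality using (_≡_; _≢_)
open import Algebra.Structures using (IsGroup)

-- A (left) quasifield whose underlying set is Fin q (every finite set with
-- q elements is in bijection with Fin q, so this is no loss of generality).
record Quasifield (q : ℕ) : Set where
  infixl 6 _+_
  infixl 7 _·_
  field
    _+_ : Fin q → Fin q → Fin q
    _·_ : Fin q → Fin q → Fin q
    -_  : Fin q → Fin q
    0#  : Fin q
    1#  : Fin q
    +-isGroup : IsGroup {A = Fin q} _≡_ _+_ 0# -_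
    -- (Q \ {0}, ·) is a loop with identity 1
    1≢0      : 1# ≢ 0#
    ·-closed : ∀ a b → a ≢ 0# → b ≢ 0# → a · b ≢ 0#
    ·-identityˡ : ∀ x → x ≢ 0# → 1# · x ≡ x
    ·-identityʳ : ∀ x → x ≢ 0# → x · 1# ≡ x
    left-div  : ∀ a b → a ≢ 0# → b ≢ 0# → ∃! _≡_ (λ x → x ≢ 0# × a · x ≡ b)
    right-div : ∀ a b → a ≢ 0# → b ≢ 0# → ∃! _≡_ (λ y → y ≢ 0# × y · a ≡ b)
    distribˡ : ∀ a b c → a · (b + c) ≡ a · b + a · c
    zeroˡ : ∀ x → 0# · x ≡ 0#
    unique-sol : ∀ a b c → a ≢ b → ∃! _≡_ (λ x → a · x ≡ b · x + c)

sumProd : ∀ {q} → Quasifield q → Subset q → Subset q → Subset q → Subset q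
sumProd {q} Qf A B C = tabulate λ x →
  ⌊ any? (λ a → any? (λ b → any? (λ c →
      (a ∈? A) ×-dec ((b ∈? B) ×-dec ((c ∈? C) ×-dec ((a + b · c) ≟ x)))))) ⌋
  where open Quasifield Qf

-- Let K = |A||C| and, for each b, let r_b(y) count the pairs (a, c) ∈ A × C with a + b·c = y,
-- so that Σ_y r_b(y) = K.  For c ≠ c', two solutions b₁ ≠ b₂ of a + b·c = a' + b·c' would give
-- b₁·g = b₂·g with g = c − c' ≠ 0, so both 0 and g would solve b₁·x = b₂·x + 0, against the
-- uniqueness axiom.  Counting coincidences therefore bounds the energies E_b = Σ_y r_b(y)² by
-- Σ_b E_b ≤ K(q + K).  Cauchy–Schwarz gives K² ≤ q·E_b for every b, and K² ≤ |S|·E_b for b ∈ B,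
-- since then r_b is supported on S = A + B·C.  Summing (|S| + (q − |S|)[b ∈ B])·K² ≤ q|S|·E_b
-- over b yields (q − |S|)|B|K ≤ q²|S|, which rearranges to the claim.

{-# OPTIONS --safe #-}
module Submission where

open import Defs
open import Algebra.Bundles using (Group)
import Algebra.Properties.Group as GroupProperties
open import Data.Bool.Base using (Bool; true; false)
open import Data.Empty using (⊥-elim)
open import Data.Fin.Base using (Fin; zero; suc)
open import Data.Fin.Properties using (_≟_; 0≢1+n; suc-injective; any?)
open import Data.Fin.Subset using (Subset; ∣_∣; _∈_)
open import Data.Fin.Subset.Properties using (∣p∣≤n; _∈?_)
open import Data.Nat.Base using (ℕ; zero; suc; _+_; _*_; _∸_; _≤_; z≤n; s≤s)
open import Data.Nat.Properties hiding (_≟_; 0≢1+n; suc-injective)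
open import Data.Nat.Tactic.RingSolver using (solve-∀)
open import Data.Product.Base using (_×_; _,_; ∃)
open import Data.Sum.Base using ([_,_]′)
open import Data.Vec.Base using (_∷_; []; lookup)
open import Data.Vec.Properties using (lookup∘tabulate; lookup⇒[]=)
open import Function.Base using (_∘_; _$_)
open import Relation.Binary.PropositionalEquality
open import Relation.Nullary.Decidable using (Dec; yes; no; does; isYes; dec-true; isYes≗does; _×-dec_)

open import Algebra.Properties.Semiring.Sum +-*-semiring
  using (sum; sum-syntax; sum-cong-≗; sum-replicate-zero; ∑-comm; ∑-distrib-+; *-distribˡ-sum; *-distribʳ-sum)

sum-mono-≤ : ∀ {n} {f g : Fin n → ℕ} → (∀ i → f i ≤ g i) → sum f ≤ sum g
sum-mono-≤ {zero}  f≤g = z≤n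
sum-mono-≤ {suc n} f≤g = +-mono-≤ (f≤g zero) (sum-mono-≤ (f≤g ∘ suc))

sum-const : ∀ n x → ∑[ i < n ] x ≡ n * x
sum-const zero    x = refl
sum-const (suc n) x = cong (x +_) (sum-const n x)

∑∑ : ∀ {m k} → (Fin m → Fin k → ℕ) → ℕ
∑∑ {m} {k} f = ∑[ i < m ] ∑[ j < k ] f i j

module _ {m k : ℕ} where

  ∑∑-cong : {f g : Fin m → Fin k → ℕ} → (∀ i j → f i j ≡ g i j) → ∑∑ f ≡ ∑∑ g
  ∑∑-cong f≡g = sum-cong-≗ λ i → sum-cong-≗ (f≡g i)

  ∑∑-mono-≤ : {f g : Fin m → Fin k → ℕ} → (∀ i j → f i j ≤ g i j) → ∑∑ f ≤ ∑∑ g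
  ∑∑-mono-≤ f≤g = sum-mono-≤ λ i → sum-mono-≤ (f≤g i)

  ∑∑-distrib-+ : (f g : Fin m → Fin k → ℕ) → ∑∑ (λ i j → f i j + g i j) ≡ ∑∑ f + ∑∑ g
  ∑∑-distrib-+ f g =
    trans (sum-cong-≗ λ i → ∑-distrib-+ (f i) (g i)) (∑-distrib-+ (λ i → sum (f i)) (λ i → sum (g i)))

  *-distribˡ-∑∑ : ∀ x (f : Fin m → Fin k → ℕ) → x * ∑∑ f ≡ ∑∑ (λ i j → x * f i j)
  *-distribˡ-∑∑ x f =
    trans (*-distribˡ-sum x (λ i → sum (f i))) (sum-cong-≗ λ i → *-distribˡ-sum x (f i))

  *-distribʳ-∑∑ : ∀ x (f : Fin m → Fin k → ℕ) → ∑∑ f * x ≡ ∑∑ (λ i j → f i j * x)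
  *-distribʳ-∑∑ x f =
    trans (*-distribʳ-sum x (λ i → sum (f i))) (sum-cong-≗ λ i → *-distribʳ-sum x (f i))

  ∑∑-separable : (f : Fin m → ℕ) (g : Fin k → ℕ) → ∑∑ (λ i j → f i * g j) ≡ sum f * sum g
  ∑∑-separable f g =
    sym (trans (*-distribʳ-sum (sum g) f) (sum-cong-≗ λ i → *-distribˡ-sum (f i) g))

  ∑-∑∑-comm : ∀ {n} (f : Fin n → Fin m → Fin k → ℕ) →
              ∑[ b < n ] ∑∑ (f b) ≡ ∑∑ (λ i j → ∑[ b < n ] f b i j)
  ∑-∑∑-comm f = trans (∑-comm (λ b i → sum (f b i))) (sum-cong-≗ λ i → ∑-comm (λ b → f b i))

𝟙 : Bool → ℕ
𝟙 true  = 1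
𝟙 false = 0

𝟙≤1 : ∀ x → 𝟙 x ≤ 1
𝟙≤1 true  = s≤s z≤n
𝟙≤1 false = z≤n

𝟙-idem : ∀ x → 𝟙 x * 𝟙 x ≡ 𝟙 x
𝟙-idem true  = refl
𝟙-idem false = refl

χ : ∀ {n} → Subset n → Fin n → ℕ
χ p i = 𝟙 (lookup p i)

∣p∣≡∑χ : ∀ {n} (p : Subset n) → ∣ p ∣ ≡ sum (χ p)
∣p∣≡∑χ []          = refl
∣p∣≡∑χ (true ∷ p)  = cong suc (∣p∣≡∑χ p)
∣p∣≡∑χ (false ∷ p) = ∣p∣≡∑χ p

δ : ∀ {n} → Fin n → Fin n → ℕ
δ i j = 𝟙 (does (i ≟ j))

δ-≢ : ∀ {n} {i j : Fin n} → i ≢ j → δ i j ≡ 0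
δ-≢ {i = i} {j = j} i≢j with i ≟ j
... | yes i≡j = ⊥-elim (i≢j i≡j)
... | no  _   = refl

∑-δ-select : ∀ {n} (i : Fin n) (f : Fin n → ℕ) → ∑[ j < n ] (δ i j * f j) ≡ f i
∑-δ-select {suc n} zero    f =
  trans (cong₂ _+_ (+-identityʳ (f zero)) (sum-replicate-zero n)) (+-identityʳ (f zero))
∑-δ-select {suc n} (suc i) f = ∑-δ-select i (f ∘ suc)

∑-δ : ∀ {n} (i : Fin n) → ∑[ j < n ] δ i j ≡ 1
∑-δ i = trans (sum-cong-≗ λ j → sym (*-identityʳ (δ i j))) (∑-δ-select i (λ _ → 1))

∑-δ≤1 : ∀ {m n} (x y : Fin m → Fin n) → (∀ i j → x i ≡ y i → x j ≡ y j → i ≡ j) →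
        ∑[ i < m ] δ (x i) (y i) ≤ 1
∑-δ≤1 {zero}  x y agree = z≤n
∑-δ≤1 {suc m} x y agree with x zero ≟ y zero
... | no  _  = ∑-δ≤1 (x ∘ suc) (y ∘ suc) λ i j eᵢ eⱼ → suc-injective (agree (suc i) (suc j) eᵢ eⱼ)
... | yes e₀ = ≤-reflexive $ cong suc $
  trans (sum-cong-≗ λ i → δ-≢ (0≢1+n ∘ agree zero (suc i) e₀)) (sum-replicate-zero m)

2xy≤x²+y² : ∀ x y → 2 * (x * y) ≤ x * x + y * y
2xy≤x²+y² x y = [ ordered , flipped ]′ (≤-total x y)
  where
  square-gap : ∀ x t → 2 * (x * (x + t)) + t * t ≡ x * x + (x + t) * (x + t)
  square-gap = solve-∀

  ordered : ∀ {x y} → x ≤ y → 2 * (x * y) ≤ x * x + y * y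
  ordered {x} x≤y with t , refl ← m≤n⇒∃[o]m+o≡n x≤y =
    subst (2 * (x * (x + t)) ≤_) (square-gap x t) (m≤m+n _ (t * t))

  flipped : y ≤ x → 2 * (x * y) ≤ x * x + y * y
  flipped y≤x = subst₂ _≤_ (cong (2 *_) (*-comm y x)) (+-comm (y * y) (x * x)) (ordered y≤x)

cauchy-schwarz : ∀ {n} (u v : Fin n → ℕ) →
  ∑[ i < n ] (u i * v i) * ∑[ i < n ] (u i * v i) ≤ ∑[ i < n ] (u i * u i) * ∑[ i < n ] (v i * v i)
cauchy-schwarz {n} u v = *-cancelˡ-≤ 2 $ begin
  2 * (sum uv * sum uv)
    ≡⟨ cong (2 *_) (∑∑-separable uv uv) ⟨
  2 * ∑∑ (λ i j → uv i * uv j)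
    ≡⟨ *-distribˡ-∑∑ 2 (λ i j → uv i * uv j) ⟩
  ∑∑ (λ i j → 2 * (uv i * uv j))
    ≡⟨ ∑∑-cong (λ i j → cong (2 *_) (regroup (u i) (v i) (u j) (v j))) ⟩
  ∑∑ (λ i j → 2 * (u i * v j * (u j * v i)))
    ≤⟨ ∑∑-mono-≤ (λ i j → 2xy≤x²+y² (u i * v j) (u j * v i)) ⟩
  ∑∑ (λ i j → crossed i j + crossed j i)
    ≡⟨ ∑∑-distrib-+ crossed (λ i j → crossed j i) ⟩
  ∑∑ crossed + ∑∑ (λ i j → crossed j i)
    ≡⟨ cong (∑∑ crossed +_) (∑-comm λ i j → crossed j i) ⟩
  ∑∑ crossed + ∑∑ crossed
    ≡⟨ cong (λ t → t + t) ∑∑crossed ⟩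
  sum uu * sum vv + sum uu * sum vv
    ≡⟨ cong (sum uu * sum vv +_) (+-identityʳ _) ⟨
  2 * (sum uu * sum vv) ∎
  where
  open ≤-Reasoning
  uv uu vv : Fin n → ℕ
  uv i = u i * v i
  uu i = u i * u i
  vv i = v i * v i

  crossed : Fin n → Fin n → ℕ
  crossed i j = u i * v j * (u i * v j)

  regroup : ∀ a b c d → a * b * (c * d) ≡ a * d * (c * b)
  regroup = solve-∀

  square-product : ∀ a b → a * b * (a * b) ≡ a * a * (b * b)
  square-product = solve-∀

  ∑∑crossed : ∑∑ crossed ≡ sum uu * sum vv
  ∑∑crossed = trans (∑∑-cong λ i j → square-product (u i) (v j)) (∑∑-separable uu vv)

cauchy-schwarz-indicator : ∀ {n} (u f : Fin n → ℕ) →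
  (∀ i → u i * u i ≡ u i) → (∀ i → u i * f i ≡ f i) → sum f * sum f ≤ sum u * ∑[ i < n ] (f i * f i)
cauchy-schwarz-indicator u f u-idem u-supports-f = subst₂ _≤_
  (cong₂ _*_ (sum-cong-≗ u-supports-f) (sum-cong-≗ u-supports-f))
  (cong (_* _) (sum-cong-≗ u-idem))
  (cauchy-schwarz u f)

module Representation {m k n : ℕ} (w : Fin m → Fin k → ℕ) (p : Fin m → Fin k → Fin n) where

  rep : Fin n → ℕ
  rep y = ∑∑ λ i j → w i j * δ (p i j) y

  ∑-rep : sum rep ≡ ∑∑ w
  ∑-rep = begin
    ∑[ y < n ] ∑∑ (λ i j → w i j * δ (p i j) y)
      ≡⟨ ∑-∑∑-comm (λ y i j → w i j * δ (p i j) y) ⟩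
    ∑∑ (λ i j → ∑[ y < n ] (w i j * δ (p i j) y))
      ≡⟨ ∑∑-cong (λ i j → *-distribˡ-sum (w i j) (δ (p i j))) ⟨
    ∑∑ (λ i j → w i j * sum (δ (p i j)))
      ≡⟨ ∑∑-cong (λ i j → trans (cong (w i j *_) (∑-δ (p i j))) (*-identityʳ (w i j))) ⟩
    ∑∑ w ∎
    where open ≡-Reasoning

  ∑-rep² : ∑[ y < n ] (rep y * rep y) ≡ ∑∑ (λ i j → w i j * rep (p i j))
  ∑-rep² = begin
    ∑[ y < n ] (rep y * rep y)
      ≡⟨ sum-cong-≗ (λ y → *-distribʳ-∑∑ (rep y) (λ i j → w i j * δ (p i j) y)) ⟩
    ∑[ y < n ] ∑∑ (λ i j → w i j * δ (p i j) y * rep y)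
      ≡⟨ ∑-∑∑-comm (λ y i j → w i j * δ (p i j) y * rep y) ⟩
    ∑∑ (λ i j → ∑[ y < n ] (w i j * δ (p i j) y * rep y))
      ≡⟨ ∑∑-cong (λ i j → sum-cong-≗ λ y → *-assoc (w i j) (δ (p i j) y) (rep y)) ⟩
    ∑∑ (λ i j → ∑[ y < n ] (w i j * (δ (p i j) y * rep y)))
      ≡⟨ ∑∑-cong (λ i j → *-distribˡ-sum (w i j) (λ y → δ (p i j) y * rep y)) ⟨
    ∑∑ (λ i j → w i j * ∑[ y < n ] (δ (p i j) y * rep y))
      ≡⟨ ∑∑-cong (λ i j → cong (w i j *_) (∑-δ-select (p i j) rep)) ⟩
    ∑∑ (λ i j → w i j * rep (p i j)) ∎
    where open ≡-Reasoning

  rep-supported : (u : Fin n → ℕ) → (∀ i j → u (p i j) * w i j ≡ w i j) → ∀ y → u y * rep y ≡ rep y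
  rep-supported u u-supports-w y =
    trans (*-distribˡ-∑∑ (u y) (λ i j → w i j * δ (p i j) y)) (∑∑-cong termwise)
    where
    termwise : ∀ i j → u y * (w i j * δ (p i j) y) ≡ w i j * δ (p i j) y
    termwise i j with p i j ≟ y
    ... | yes refl = trans (sym (*-assoc (u y) (w i j) 1)) (cong (_* 1) (u-supports-w i j))
    ... | no  _    =
      trans (cong (u y *_) (*-zeroʳ (w i j))) (trans (*-zeroʳ (u y)) (sym (*-zeroʳ (w i j))))

module QuasifieldProperties {q : ℕ} (Qf : Quasifield q) where

  open Quasifield Qf renaming (_+_ to _⊕_)

  +-group : Group _ _
  +-group = record { isGroup = +-isGroup }

  open Group +-group using (assoc; identityʳ)
  open GroupProperties +-group using (∙-cancelˡ; ∙-cancelʳ; //-rightDividesˡ; x∙y⁻¹≈ε⇒x≈y)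

  ·-zeroʳ : ∀ x → x · 0# ≡ 0#
  ·-zeroʳ x = ∙-cancelˡ (x · 0#) (x · 0#) 0# $ begin
    x · 0# ⊕ x · 0#  ≡⟨ distribˡ x 0# 0# ⟨
    x · (0# ⊕ 0#)    ≡⟨ cong (x ·_) (identityʳ 0#) ⟩
    x · 0#           ≡⟨ identityʳ (x · 0#) ⟨
    x · 0# ⊕ 0#      ∎
    where open ≡-Reasoning

  ·-cancelʳ : ∀ {g} → g ≢ 0# → ∀ x y → x · g ≡ y · g → x ≡ y
  ·-cancelʳ {g} g≢0 x y xg≡yg with x ≟ y
  ... | yes x≡y = x≡y
  ... | no  x≢y with _ , _ , unique ← unique-sol x y 0# x≢y =
    ⊥-elim (g≢0 (trans (sym (unique g-solves)) (unique 0-solves)))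
    where
    g-solves : x · g ≡ y · g ⊕ 0#
    g-solves = trans xg≡yg (sym (identityʳ (y · g)))
    0-solves : x · 0# ≡ y · 0# ⊕ 0#
    0-solves = trans (·-zeroʳ x) (sym (trans (identityʳ (y · 0#)) (·-zeroʳ y)))

  slope-unique : ∀ {a a' c c'} → c ≢ c' → ∀ {x y} →
                 a ⊕ x · c ≡ a' ⊕ x · c' → a ⊕ y · c ≡ a' ⊕ y · c' → x ≡ y
  slope-unique {a} {a'} {c} {c'} c≢c' {x} {y} eqx eqy =
    ·-cancelʳ g≢0 x y (∙-cancelˡ a (x · g) (y · g) (trans (translate eqx) (sym (translate eqy))))
    where
    g : Fin q
    g = c ⊕ - c'

    g≢0 : g ≢ 0#
    g≢0 = c≢c' ∘ x∙y⁻¹≈ε⇒x≈y c c'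

    translate : ∀ {z} → a ⊕ z · c ≡ a' ⊕ z · c' → a ⊕ z · g ≡ a'
    translate {z} eq = ∙-cancelʳ (z · c') (a ⊕ z · g) a' $ begin
      a ⊕ z · g ⊕ z · c'    ≡⟨ assoc a (z · g) (z · c') ⟩
      a ⊕ (z · g ⊕ z · c')  ≡⟨ cong (a ⊕_) (distribˡ z g c') ⟨
      a ⊕ z · (g ⊕ c')      ≡⟨ cong (λ t → a ⊕ z · t) (//-rightDividesˡ c' c) ⟩
      a ⊕ z · c             ≡⟨ eq ⟩
      a' ⊕ z · c'           ∎
      where open ≡-Reasoning

  agreements≤ : ∀ a c a' c' → ∑[ b < q ] δ (a' ⊕ b · c') (a ⊕ b · c) ≤ q * (δ a a' * δ c c') + 1
  agreements≤ a c a' c' with c ≟ c' | a ≟ a'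
  ... | no c≢c'  | _       =
    ≤-trans (∑-δ≤1 _ _ λ x y eqx eqy → slope-unique c≢c' (sym eqx) (sym eqy)) (m≤n+m 1 _)
  ... | yes refl | yes refl =
    ≤-trans (sum-mono-≤ λ b → 𝟙≤1 (does (a ⊕ b · c ≟ a ⊕ b · c)))
            (≤-trans (≤-reflexive (sum-const q 1)) (m≤m+n (q * 1) 1))
  ... | yes refl | no a≢a'  = ≤-trans (≤-reflexive no-agreement) z≤n
    where
    no-agreement : ∑[ b < q ] δ (a' ⊕ b · c) (a ⊕ b · c) ≡ 0
    no-agreement =
      trans (sum-cong-≗ λ b → δ-≢ (a≢a' ∘ sym ∘ ∙-cancelʳ (b · c) a' a)) (sum-replicate-zero q)

module Energy {q : ℕ} (Qf : Quasifield q) (A B C : Subset q) where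

  open Quasifield Qf using (_·_) renaming (_+_ to _⊕_)
  open QuasifieldProperties Qf using (agreements≤)

  S : Subset q
  S = sumProd Qf A B C

  lookup-S : ∀ {a b c} → lookup A a ≡ true → lookup B b ≡ true → lookup C c ≡ true →
             lookup S (a ⊕ b · c) ≡ true
  lookup-S {a} {b} {c} a∈A b∈B c∈C =
    trans (lookup∘tabulate (isYes ∘ generated?) (a ⊕ b · c)) $
    trans (isYes≗does (generated? (a ⊕ b · c))) $
    dec-true (generated? (a ⊕ b · c))
      (a , b , c , lookup⇒[]= a A a∈A , lookup⇒[]= b B b∈B , lookup⇒[]= c C c∈C , refl)
    where
    generated? : ∀ x → Dec (∃ λ a → ∃ λ b → ∃ λ c → a ∈ A × b ∈ B × c ∈ C × a ⊕ b · c ≡ x)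
    generated? x =
      any? λ a → any? λ b → any? λ c → a ∈? A ×-dec b ∈? B ×-dec c ∈? C ×-dec a ⊕ b · c ≟ x

  χA×C : Fin q → Fin q → ℕ
  χA×C a c = χ A a * χ C c

  χA×C≤1 : ∀ a c → χA×C a c ≤ 1
  χA×C≤1 a c = *-mono-≤ (𝟙≤1 (lookup A a)) (𝟙≤1 (lookup C c))

  K : ℕ
  K = ∑∑ χA×C

  K≡∣A∣*∣C∣ : K ≡ ∣ A ∣ * ∣ C ∣
  K≡∣A∣*∣C∣ = trans (∑∑-separable (χ A) (χ C)) (sym (cong₂ _*_ (∣p∣≡∑χ A) (∣p∣≡∑χ C)))

  module Slope (b : Fin q) = Representation χA×C (λ a c → a ⊕ b · c)
  open Slope using (rep; ∑-rep; ∑-rep²; rep-supported)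

  energy : Fin q → ℕ
  energy b = ∑[ y < q ] (rep b y * rep b y)

  ∑-rep-along : ∀ a c → ∑[ b < q ] rep b (a ⊕ b · c) ≤ q + K
  ∑-rep-along a c = begin
    ∑[ b < q ] rep b (a ⊕ b · c)
      ≡⟨ ∑-∑∑-comm (λ b a' c' → χA×C a' c' * δ (a' ⊕ b · c') (a ⊕ b · c)) ⟩
    ∑∑ (λ a' c' → ∑[ b < q ] (χA×C a' c' * δ (a' ⊕ b · c') (a ⊕ b · c)))
      ≡⟨ ∑∑-cong (λ a' c' → *-distribˡ-sum (χA×C a' c') (λ b → δ (a' ⊕ b · c') (a ⊕ b · c))) ⟨
    ∑∑ (λ a' c' → χA×C a' c' * ∑[ b < q ] δ (a' ⊕ b · c') (a ⊕ b · c))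
      ≤⟨ ∑∑-mono-≤ (λ a' c' → weighted (χA×C≤1 a' c') (agreements≤ a c a' c')) ⟩
    ∑∑ (λ a' c' → q * (δ a a' * δ c c') + χA×C a' c')
      ≡⟨ ∑∑-distrib-+ (λ a' c' → q * (δ a a' * δ c c')) χA×C ⟩
    ∑∑ (λ a' c' → q * (δ a a' * δ c c')) + K
      ≡⟨ cong (_+ K) (*-distribˡ-∑∑ q (λ a' c' → δ a a' * δ c c')) ⟨
    q * ∑∑ (λ a' c' → δ a a' * δ c c') + K
      ≡⟨ cong (λ t → q * t + K) (trans (∑∑-separable (δ a) (δ c)) (cong₂ _*_ (∑-δ a) (∑-δ c))) ⟩
    q * 1 + K
      ≡⟨ cong (_+ K) (*-identityʳ q) ⟩
    q + K ∎
    where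
    open ≤-Reasoning
    weighted : ∀ {x y z} → x ≤ 1 → y ≤ z + 1 → x * y ≤ z + x
    weighted {x} {y} {z} x≤1 y≤z+1 = begin
      x * y          ≤⟨ *-monoʳ-≤ x y≤z+1 ⟩
      x * (z + 1)    ≡⟨ *-distribˡ-+ x z 1 ⟩
      x * z + x * 1  ≤⟨ +-mono-≤ (*-monoˡ-≤ z x≤1) ≤-refl ⟩
      1 * z + x * 1  ≡⟨ cong₂ _+_ (*-identityˡ z) (*-identityʳ x) ⟩
      z + x          ∎

  ∑-energy≤ : ∑[ b < q ] energy b ≤ K * (q + K)
  ∑-energy≤ = begin
    ∑[ b < q ] energy b
      ≡⟨ sum-cong-≗ ∑-rep² ⟩
    ∑[ b < q ] ∑∑ (λ a c → χA×C a c * rep b (a ⊕ b · c))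
      ≡⟨ ∑-∑∑-comm (λ b a c → χA×C a c * rep b (a ⊕ b · c)) ⟩
    ∑∑ (λ a c → ∑[ b < q ] (χA×C a c * rep b (a ⊕ b · c)))
      ≡⟨ ∑∑-cong (λ a c → *-distribˡ-sum (χA×C a c) (λ b → rep b (a ⊕ b · c))) ⟨
    ∑∑ (λ a c → χA×C a c * ∑[ b < q ] rep b (a ⊕ b · c))
      ≤⟨ ∑∑-mono-≤ (λ a c → *-monoʳ-≤ (χA×C a c) (∑-rep-along a c)) ⟩
    ∑∑ (λ a c → χA×C a c * (q + K))
      ≡⟨ *-distribʳ-∑∑ (q + K) χA×C ⟨
    K * (q + K) ∎
    where open ≤-Reasoning

  K²≤q*energy : ∀ b → K * K ≤ q * energy b
  K²≤q*energy b = subst₂ _≤_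
    (cong₂ _*_ (∑-rep b) (∑-rep b))
    (cong (_* energy b) (trans (sum-const q 1) (*-identityʳ q)))
    (cauchy-schwarz-indicator (λ _ → 1) (rep b) (λ _ → refl) (λ y → *-identityˡ (rep b y)))

  K²≤∣S∣*energy : ∀ {b} → lookup B b ≡ true → K * K ≤ ∣ S ∣ * energy b
  K²≤∣S∣*energy {b} b∈B = subst₂ _≤_
    (cong₂ _*_ (∑-rep b) (∑-rep b))
    (cong (_* energy b) (sym (∣p∣≡∑χ S)))
    (cauchy-schwarz-indicator (χ S) (rep b) (𝟙-idem ∘ lookup S) (rep-supported b (χ S) S-supports-χA×C))
    where
    S-supports-χA×C : ∀ a c → χ S (a ⊕ b · c) * χA×C a c ≡ χA×C a c
    S-supports-χA×C a c with lookup A a in a∈A | lookup C c in c∈C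
    ... | true  | true  rewrite lookup-S a∈A b∈B c∈C = refl
    ... | true  | false = *-zeroʳ (χ S (a ⊕ b · c))
    ... | false | _     = *-zeroʳ (χ S (a ⊕ b · c))

  s d : ℕ
  s = ∣ S ∣
  d = q ∸ s

  s+d≡q : s + d ≡ q
  s+d≡q = m+[n∸m]≡n (∣p∣≤n S)

  weighted-K²≤energy : ∀ b → (s + d * χ B b) * (K * K) ≤ q * s * energy b
  weighted-K²≤energy b with lookup B b in b∈B
  ... | true  = begin
    (s + d * 1) * (K * K)  ≡⟨ cong (λ t → t * (K * K)) (trans (cong (s +_) (*-identityʳ d)) s+d≡q) ⟩
    q * (K * K)            ≤⟨ *-monoʳ-≤ q (K²≤∣S∣*energy b∈B) ⟩
    q * (s * energy b)     ≡⟨ *-assoc q s (energy b) ⟨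
    q * s * energy b       ∎
    where open ≤-Reasoning
  ... | false = begin
    (s + d * 0) * (K * K)  ≡⟨ cong (λ t → t * (K * K)) (trans (cong (s +_) (*-zeroʳ d)) (+-identityʳ s)) ⟩
    s * (K * K)            ≤⟨ *-monoʳ-≤ s (K²≤q*energy b) ⟩
    s * (q * energy b)     ≡⟨ *-assoc s q (energy b) ⟨
    s * q * energy b       ≡⟨ cong (_* energy b) (*-comm s q) ⟩
    q * s * energy b       ∎
    where open ≤-Reasoning

  energy-inequality : (q * s + d * ∣ B ∣) * (K * K) ≤ q * s * (K * (q + K))
  energy-inequality = begin
    (q * s + d * ∣ B ∣) * (K * K)
      ≡⟨ cong (λ t → t * (K * K)) (cong₂ _+_ (sym (sum-const q s)) ∣B∣-as-sum) ⟩
    (∑[ b < q ] s + ∑[ b < q ] (d * χ B b)) * (K * K)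
      ≡⟨ cong (λ t → t * (K * K)) (∑-distrib-+ (λ _ → s) (λ b → d * χ B b)) ⟨
    ∑[ b < q ] (s + d * χ B b) * (K * K)
      ≡⟨ *-distribʳ-sum (K * K) (λ b → s + d * χ B b) ⟩
    ∑[ b < q ] ((s + d * χ B b) * (K * K))
      ≤⟨ sum-mono-≤ weighted-K²≤energy ⟩
    ∑[ b < q ] (q * s * energy b)
      ≡⟨ *-distribˡ-sum (q * s) energy ⟨
    q * s * ∑[ b < q ] energy b
      ≤⟨ *-monoʳ-≤ (q * s) ∑-energy≤ ⟩
    q * s * (K * (q + K)) ∎
    where
    open ≤-Reasoning
    ∣B∣-as-sum : d * ∣ B ∣ ≡ ∑[ b < q ] (d * χ B b)
    ∣B∣-as-sum = trans (cong (d *_) (∣p∣≡∑χ B)) (*-distribˡ-sum d (χ B))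

cancel-common-square : ∀ x y z K → (x + y) * (K * K) ≤ x * (K * (z + K)) → y * K ≤ x * z
cancel-common-square x y z zero    _ = ≤-trans (≤-reflexive (*-zeroʳ y)) z≤n
cancel-common-square x y z K@(suc _) h =
  *-cancelʳ-≤ (y * K) (x * z) K $
  +-cancelˡ-≤ (x * (K * K)) (y * K * K) (x * z * K) $
  subst₂ _≤_ (expandˡ x y K) (expandʳ x z K) h
  where
  expandˡ : ∀ x y K → (x + y) * (K * K) ≡ x * (K * K) + y * K * K
  expandˡ = solve-∀
  expandʳ : ∀ x z K → x * (K * (z + K)) ≡ x * (K * K) + x * z * K
  expandʳ = solve-∀

theorem1p8 : (q : ℕ) (Qf : Quasifield q) (A B C : Subset q) →
    (q ∸ ∣ sumProd Qf A B C ∣) * (∣ A ∣ * ∣ B ∣ * ∣ C ∣ + q * q) ≤ q * q * q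
theorem1p8 q Qf A B C = begin
  d * (∣ A ∣ * ∣ B ∣ * ∣ C ∣ + q * q)
    ≡⟨ regroup d (∣ A ∣) (∣ B ∣) (∣ C ∣) q ⟩
  d * ∣ B ∣ * (∣ A ∣ * ∣ C ∣) + d * (q * q)
    ≡⟨ cong (λ t → d * ∣ B ∣ * t + d * (q * q)) K≡∣A∣*∣C∣ ⟨
  d * ∣ B ∣ * K + d * (q * q)
    ≤⟨ +-monoˡ-≤ (d * (q * q)) (cancel-common-square (q * s) (d * ∣ B ∣) q K energy-inequality) ⟩
  q * s * q + d * (q * q)
    ≡⟨ collect q s d ⟩
  q * q * (s + d)
    ≡⟨ cong (q * q *_) s+d≡q ⟩
  q * q * q ∎
  where
  open Energy Qf A B C
  open ≤-Reasoning
  regroup : ∀ d a b c q → d * (a * b * c + q * q) ≡ d * b * (a * c) + d * (q * q)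
  regroup = solve-∀
  collect : ∀ q s d → q * s * q + d * (q * q) ≡ q * q * (s + d)
  collect = solve-∀
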